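{- Let $p\ge1$ be an integer and $\mathbf{H}$ a set of graphs such that all $\mathbf{H}$-free graphs are perfect. Then \[ f_{pK_2\cup\mathbf{H}}(\omega)={\omega+2p \choose 2p+1} \] is a $\chi$-bounding function for the $(pK_2\cup\mathbf{H})$-free graphs.
   Context: A graph is $\mathbf{H}$-free if it has no induced subgraph isomorphic to a member of $\mathbf{H}$. A graph is perfect if $\chi(H)=\omega(H)$ for all its induced subgraphs $H$. $f$ is a $\chi$-bounding function for a class if $\chi(G)\le f(\omega(G))$ for all $G$ in it. $pK_2$ is the disjoint union of $p$ edges and $pK_2\cup\mathbf{H}=\{pK_2\cup H:H\in\mathbf{H}\}$. -}

module Defs where

open import Data.Nat using (ℕ; zero; suc; _+_; _*_; _≤_)
open import Data.Nat.Combinatorics using (_C_)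
open import Data.Bool using (Bool; true; false)
open import Data.Fin using (Fin; zero; suc; splitAt)
open import Data.Sum using (_⊎_; inj₁; inj₂)
open import Data.Product using (Σ; ∃; ∃-syntax; _×_; _,_)
open import Data.Empty using (⊥)
open import Relation.Nullary using (¬_)
open import Relation.Binary.PropositionalEquality using (_≡_; _≢_; refl)
open import Function.Definitions using (Injective)
open import Function.Bundles using (_⤖_; Bijection)

record Graph : Set where
  field
    size   : ℕ
    adj    : Fin size → Fin size → Bool
    sym    : ∀ i j → adj i j ≡ adj j i
    irrefl : ∀ i → adj i i ≡ false
open Graph public

Adjacent : (G : Graph) → Fin (size G) → Fin (size G) → Set
Adjacent G i j = adj G i j ≡ true

induced : (G : Graph) {m : ℕ} (e : Fin m → Fin (size G)) → Injective _≡_ _≡_ e → Graph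
induced G {m} e _ = record
  { size = m
  ; adj = λ i j → adj G (e i) (e j)
  ; sym = λ i j → sym G (e i) (e j)
  ; irrefl = λ i → irrefl G (e i) }

Iso : Graph → Graph → Set
Iso G H = Σ (Fin (size G) ⤖ Fin (size H)) λ φ →
  ∀ i j → adj G i j ≡ adj H (Bijection.to φ i) (Bijection.to φ j)

ContainsInduced : Graph → Graph → Set
ContainsInduced G H =
  ∃[ m ] Σ (Fin m → Fin (size G)) λ e → Σ (Injective _≡_ _≡_ e) λ inj →
    Iso (induced G e inj) H

Free : (Graph → Set) → Graph → Set
Free 𝓗 G = ∀ H → 𝓗 H → ¬ ContainsInduced G H

Colourable : Graph → ℕ → Set
Colourable G k = Σ (Fin (size G) → Fin k) λ c →
  ∀ i j → Adjacent G i j → c i ≢ c j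

IsChromaticNumber : Graph → ℕ → Set
IsChromaticNumber G k = Colourable G k × (∀ k′ → Colourable G k′ → k ≤ k′)

HasClique : Graph → ℕ → Set
HasClique G w = Σ (Fin w → Fin (size G)) λ f → Injective _≡_ _≡_ f ×
  (∀ i j → i ≢ j → Adjacent G (f i) (f j))

IsCliqueNumber : Graph → ℕ → Set
IsCliqueNumber G w = HasClique G w × ¬ HasClique G (suc w)

Perfect : Graph → Set
Perfect G = ∀ {m} (e : Fin m → Fin (size G)) (inj : Injective _≡_ _≡_ e) →
  ∀ w → IsCliqueNumber (induced G e inj) w → IsChromaticNumber (induced G e inj) w

unionAdj : (G H : Graph) → Fin (size G + size H) → Fin (size G + size H) → Bool
unionAdj G H i j with splitAt (size G) i | splitAt (size G) j
... | inj₁ a | inj₁ b = adj G a b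
... | inj₂ a | inj₂ b = adj H a b
... | inj₁ _ | inj₂ _ = false
... | inj₂ _ | inj₁ _ = false

unionSym : (G H : Graph) → ∀ i j → unionAdj G H i j ≡ unionAdj G H j i
unionSym G H i j with splitAt (size G) i | splitAt (size G) j
... | inj₁ a | inj₁ b = sym G a b
... | inj₂ a | inj₂ b = sym H a b
... | inj₁ _ | inj₂ _ = refl
... | inj₂ _ | inj₁ _ = refl

unionIrrefl : (G H : Graph) → ∀ i → unionAdj G H i i ≡ false
unionIrrefl G H i with splitAt (size G) i
... | inj₁ a = irrefl G a
... | inj₂ a = irrefl H a

_∪ᴳ_ : Graph → Graph → Graph
G ∪ᴳ H = record
  { size = size G + size H
  ; adj = unionAdj G H
  ; sym = unionSym G H
  ; irrefl = unionIrrefl G H }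

emptyGraph : Graph
emptyGraph = record { size = 0 ; adj = λ () ; sym = λ () ; irrefl = λ () }

k2adj : Fin 2 → Fin 2 → Bool
k2adj zero zero = false
k2adj zero (suc zero) = true
k2adj (suc zero) zero = true
k2adj (suc zero) (suc zero) = false

k2sym : ∀ i j → k2adj i j ≡ k2adj j i
k2sym zero zero = refl
k2sym zero (suc zero) = refl
k2sym (suc zero) zero = refl
k2sym (suc zero) (suc zero) = refl

k2irrefl : ∀ i → k2adj i i ≡ false
k2irrefl zero = refl
k2irrefl (suc zero) = refl

K2 : Graph
K2 = record { size = 2 ; adj = k2adj ; sym = k2sym ; irrefl = k2irrefl }

pK2 : ℕ → Graph
pK2 zero = emptyGraph
pK2 (suc p) = K2 ∪ᴳ pK2 p

pK2∪ : ℕ → (Graph → Set) → (Graph → Set)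
pK2∪ p 𝓗 G = ∃[ H ] (𝓗 H × G ≡ pK2 p ∪ᴳ H)

fBound : ℕ → ℕ → ℕ
fBound p ω = (ω + 2 * p) C (2 * p + 1)

ChiBounding : (Graph → Set) → (ℕ → ℕ) → Set
ChiBounding P f = ∀ G → P G → ∀ ω → IsCliqueNumber G ω →
  ∀ χ → IsChromaticNumber G χ → χ ≤ f ω

-- Induction on p and, for fixed p, on the clique number ω. For p = 0 the graphs are 𝓗-free,
-- hence perfect, so ω colours suffice. For p = q + 1 take a maximum clique x, k₁, …, k_{ω-1}.
-- The neighbours of x span no ω-clique and take f_{q+1}(ω - 1) colours by induction on ω. The
-- non-neighbours of x are peeled along the clique: those adjacent to k₁, …, k_{i-1} but not to
-- k_i miss both ends of the edge x k_i, so they induce a (qK₂ ∪ 𝓗)-free graph, and with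
-- k₁, …, k_{i-1} they still span no (ω + 1)-clique, so f_q colours them; what is left is
-- independent. Pascal's rule sums these counts to C(ω + 2q + 1, 2q + 2), and once more to
-- f_{q+1}(ω) = f_{q+1}(ω - 1) + C(ω + 2q + 1, 2q + 2).

module Submission where

open import Defs
open import Data.Nat using (ℕ; zero; suc; _+_; _*_; _≤_; _≥_; z≤n)
open import Data.Nat.Properties using (+-suc; +-comm; +-identityʳ; *-suc; ≤-trans; ≤-refl; ≤-reflexive; n≤1+n; m≤m+n)
open import Data.Nat.Combinatorics using (_C_; nC1≡n; nCn≡1; nCk+nC[k+1]≡[n+1]C[k+1])
open import Data.Bool using (true; false)
import Data.Bool.Properties as Bool
open import Data.Fin using (Fin; zero; suc; splitAt; join; _↑ˡ_; _↑ʳ_; inject≤)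
open import Data.Fin.Properties using (suc-injective; all?; any?; splitAt-↑ˡ; splitAt-↑ʳ; join-splitAt; splitAt-join; inject≤-injective; ↑ˡ-injective; ↑ʳ-injective)
  renaming (_≟_ to _≟ᶠ_)
open import Data.Vec.Functional using (Vector; []; _∷_; _++_; head; tail)
open import Data.Sum using (_⊎_; inj₁; inj₂)
open import Data.Sum.Properties using (inj₁-injective; inj₂-injective)
open import Data.Product using (Σ; ∃; ∃-syntax; _×_; _,_; proj₁; proj₂)
open import Data.Unit using (tt)
open import Function using (_∘_; id)
open import Function.Definitions using (Injective)
open import Function.Bundles using (Bijection; Surjection)
open import Function.Construct.Identity using (⤖-id)
open import Level using (0ℓ)
open import Relation.Nullary using (¬_; Dec; yes; no; contradiction)
open import Relation.Nullary.Decidable using (_→-dec_; ¬?; map′)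
open import Relation.Unary using (Pred; U; ∁; _∩_; _⊆_; Decidable)
open import Relation.Unary.Properties using (∁?; _∩?_)
open import Relation.Binary.PropositionalEquality
  using (_≡_; _≢_; _≗_; refl; trans; cong; cong₂; subst; subst₂; module ≡-Reasoning)
import Relation.Binary.PropositionalEquality as ≡

splitAt-injective : ∀ m {n} → Injective _≡_ _≡_ (splitAt m {n})
splitAt-injective m {n} {i} {j} eq = begin
  i                      ≡⟨ join-splitAt m n i ⟨
  join m n (splitAt m i) ≡⟨ cong (join m n) eq ⟩
  join m n (splitAt m j) ≡⟨ join-splitAt m n j ⟩
  j                      ∎
  where open ≡-Reasoning

join-injective : ∀ m n → Injective _≡_ _≡_ (join m n)
join-injective m n {i} {j} eq = begin
  i                      ≡⟨ splitAt-join m n i ⟨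
  splitAt m (join m n i) ≡⟨ cong (splitAt m) eq ⟩
  splitAt m (join m n j) ≡⟨ splitAt-join m n j ⟩
  j                      ∎
  where open ≡-Reasoning

↑ˡ≢↑ʳ : ∀ m n (i : Fin m) (j : Fin n) → i ↑ˡ n ≢ m ↑ʳ j
↑ˡ≢↑ʳ m n i j eq with trans (≡.sym (splitAt-↑ˡ m i n)) (trans (cong (splitAt m) eq) (splitAt-↑ʳ m n j))
... | ()

unionAdj-↑ˡ : ∀ A B i j → unionAdj A B (i ↑ˡ size B) (j ↑ˡ size B) ≡ adj A i j
unionAdj-↑ˡ A B i j rewrite splitAt-↑ˡ (size A) i (size B) | splitAt-↑ˡ (size A) j (size B) = refl

unionAdj-↑ʳ : ∀ A B i j → unionAdj A B (size A ↑ʳ i) (size A ↑ʳ j) ≡ adj B i j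
unionAdj-↑ʳ A B i j rewrite splitAt-↑ʳ (size A) (size B) i | splitAt-↑ʳ (size A) (size B) j = refl

unionAdj-↑ˡ↑ʳ : ∀ A B i j → unionAdj A B (i ↑ˡ size B) (size A ↑ʳ j) ≡ false
unionAdj-↑ˡ↑ʳ A B i j rewrite splitAt-↑ˡ (size A) i (size B) | splitAt-↑ʳ (size A) (size B) j = refl

V : Graph → Set
V G = Fin (size G)

IsClique : (G : Graph) {k : ℕ} → Vector (V G) k → Set
IsClique G K = ∀ i j → i ≢ j → Adjacent G (K i) (K j)

CommonNeighbour : (G : Graph) {k : ℕ} → Vector (V G) k → Pred (V G) 0ℓ
CommonNeighbour G K v = ∀ i → Adjacent G (K i) v

Complete : (G : Graph) {m n : ℕ} → Vector (V G) m → Vector (V G) n → Set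
Complete G K L = ∀ i j → Adjacent G (K i) (L j)

Separated : (G : Graph) {m n : ℕ} → Vector (V G) m → Vector (V G) n → Set
Separated G K L = ∀ i j → K i ≢ L j × adj G (K i) (L j) ≡ false

adjacent-sym : ∀ G {u v} → Adjacent G u v → Adjacent G v u
adjacent-sym G {u} {v} uv = trans (sym G v u) uv

adjacent⇒≢ : ∀ G {u v} → Adjacent G u v → u ≢ v
adjacent⇒≢ G {u} uv refl = contradiction (trans (≡.sym (irrefl G u)) uv) λ ()

neighbour≢non-neighbour : ∀ G {u v w} → Adjacent G u v → adj G u w ≡ false → v ≢ w
neighbour≢non-neighbour G uv uw refl = contradiction (trans (≡.sym uw) uv) λ ()

adjacent? : ∀ G u → Decidable (Adjacent G u)
adjacent? G u v = adj G u v Bool.≟ true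

¬adjacent⇒false : ∀ G {u v} → ¬ Adjacent G u v → adj G u v ≡ false
¬adjacent⇒false G = Bool.¬-not

commonNeighbour? : ∀ G {k} (K : Vector (V G) k) → Decidable (CommonNeighbour G K)
commonNeighbour? G K v = all? λ i → adjacent? G (K i) v

isClique⇒hasClique : ∀ G {k} {K : Vector (V G) k} → IsClique G K → HasClique G k
isClique⇒hasClique G {K = K} K-clique = K , K-injective , K-clique
  where
  K-injective : Injective _≡_ _≡_ K
  K-injective {i} {j} Ki≡Kj with i ≟ᶠ j
  ... | yes i≡j = i≡j
  ... | no i≢j = contradiction Ki≡Kj (adjacent⇒≢ G (K-clique i j i≢j))

edge-isClique : ∀ G {u v} → Adjacent G u v → IsClique G (u ∷ v ∷ [])
edge-isClique G uv zero       zero       0≢0 = contradiction refl 0≢0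
edge-isClique G uv zero       (suc zero) _   = uv
edge-isClique G uv (suc zero) zero       _   = adjacent-sym G uv
edge-isClique G uv (suc zero) (suc zero) 1≢1 = contradiction refl 1≢1

∷-isClique : ∀ G {k v} {K : Vector (V G) k} →
  CommonNeighbour G K v → IsClique G K → IsClique G (v ∷ K)
∷-isClique G v-common K-clique zero    zero    0≢0 = contradiction refl 0≢0
∷-isClique G v-common K-clique zero    (suc j) _   = adjacent-sym G (v-common j)
∷-isClique G v-common K-clique (suc i) zero    _   = v-common i
∷-isClique G v-common K-clique (suc i) (suc j) i≢j = K-clique i j (i≢j ∘ cong suc)

tail-isClique : ∀ G {k} {K : Vector (V G) (suc k)} → IsClique G K → IsClique G (tail K)
tail-isClique G K-clique i j i≢j = K-clique (suc i) (suc j) (i≢j ∘ suc-injective)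

++-isClique : ∀ G {m n} {K : Vector (V G) m} {L : Vector (V G) n} →
  IsClique G K → IsClique G L → Complete G K L → IsClique G (K ++ L)
++-isClique G {m} K-clique L-clique K-L i j i≢j
  with splitAt m i in eqi | splitAt m j in eqj
... | inj₁ a | inj₁ b = K-clique a b λ { refl → i≢j (splitAt-injective m (trans eqi (≡.sym eqj))) }
... | inj₂ a | inj₂ b = L-clique a b λ { refl → i≢j (splitAt-injective m (trans eqi (≡.sym eqj))) }
... | inj₁ a | inj₂ b = K-L a b
... | inj₂ a | inj₁ b = adjacent-sym G (K-L b a)

-- Without function extensionality Q has to respect pointwise equality.
any-vector? : ∀ k {n} {Q : Pred (Vector (Fin n) k) 0ℓ} →
  (∀ {f g} → f ≗ g → Q f → Q g) → Decidable Q → Dec (∃ Q)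
any-vector? zero    Q-resp Q? = map′ ([] ,_) (Q-resp (λ ()) ∘ proj₂) (Q? [])
any-vector? (suc k) Q-resp Q? =
  map′ (λ (a , f , Qaf) → a ∷ f , Qaf)
       (λ (f , Qf) → head f , tail f , Q-resp (λ { zero → refl ; (suc i) → refl }) Qf)
       (any? λ a → any-vector? k (λ f≗g → Q-resp λ { zero → refl ; (suc i) → f≗g i }) (Q? ∘ (a ∷_)))

hasClique? : ∀ G k → Dec (HasClique G k)
hasClique? G k = map′ (isClique⇒hasClique G ∘ proj₂) (λ (K , _ , K-clique) → K , K-clique)
  (any-vector? k resp λ K → all? λ i → all? λ j → ¬? (i ≟ᶠ j) →-dec adjacent? G (K i) (K j))
  where
  resp : ∀ {K L} → K ≗ L → IsClique G K → IsClique G L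
  resp K≗L K-clique i j i≢j = subst₂ (Adjacent G) (K≗L i) (K≗L j) (K-clique i j i≢j)

cliqueNumber-≤ : ∀ G w → ¬ HasClique G (suc w) → ∃[ ω ] ω ≤ w × IsCliqueNumber G ω
cliqueNumber-≤ G zero    no-1 = zero , z≤n , ([] , (λ {}) , λ ()) , no-1
cliqueNumber-≤ G (suc w) no-w+2 with hasClique? G (suc w)
... | yes clique = suc w , ≤-refl , clique , no-w+2
... | no no-w+1 with ω , ω≤w , isω ← cliqueNumber-≤ G w no-w+1 = ω , ≤-trans ω≤w (n≤1+n w) , isω

ColourableOn : (G : Graph) → Pred (V G) 0ℓ → ℕ → Set
ColourableOn G P k = Σ (∀ {v} → P v → Fin k) λ c →
  ∀ {u v} (u∈P : P u) (v∈P : P v) → Adjacent G u v → c u∈P ≢ c v∈P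

colourableOn-⊆ : ∀ G {P Q k} → P ⊆ Q → ColourableOn G Q k → ColourableOn G P k
colourableOn-⊆ G P⊆Q (c , proper) = (λ p → c (P⊆Q p)) , λ u∈P v∈P → proper (P⊆Q u∈P) (P⊆Q v∈P)

colourableOn-split : ∀ G {P Q a b} → Decidable Q →
  ColourableOn G (P ∩ Q) a → ColourableOn G (P ∩ ∁ Q) b → ColourableOn G P (a + b)
colourableOn-split G {P} {Q} {a} {b} Q? (c₁ , proper₁) (c₂ , proper₂) = join a b ∘ c , proper
  where
  c : ∀ {v} → P v → Fin a ⊎ Fin b
  c {v} v∈P with Q? v
  ... | yes v∈Q = inj₁ (c₁ (v∈P , v∈Q))
  ... | no v∉Q = inj₂ (c₂ (v∈P , v∉Q))
  proper : ∀ {u v} (u∈P : P u) (v∈P : P v) → Adjacent G u v → join a b (c u∈P) ≢ join a b (c v∈P)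
  proper {u} {v} u∈P v∈P uv same-colour with Q? u | Q? v
  ... | yes u∈Q | yes v∈Q = proper₁ (u∈P , u∈Q) (v∈P , v∈Q) uv (inj₁-injective (join-injective a b same-colour))
  ... | no u∉Q  | no v∉Q  = proper₂ (u∈P , u∉Q) (v∈P , v∉Q) uv (inj₂-injective (join-injective a b same-colour))
  ... | yes _   | no _    = contradiction (join-injective a b {inj₁ _} {inj₂ _} same-colour) λ ()
  ... | no _    | yes _   = contradiction (join-injective a b {inj₂ _} {inj₁ _} same-colour) λ ()

colourableOn-U⇒colourable : ∀ G {k} → ColourableOn G U k → Colourable G k
colourableOn-U⇒colourable G (c , proper) = (λ _ → c tt) , λ _ _ → proper tt tt

colourable-≤ : ∀ G {k k′} → k ≤ k′ → Colourable G k → Colourable G k′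
colourable-≤ G k≤k′ (c , proper) =
  (λ v → inject≤ (c v) k≤k′) , λ u v uv → proper u v uv ∘ inject≤-injective k≤k′ k≤k′ _ _

¬hasClique-one⇒colourable : ∀ G k → ¬ HasClique G 1 → Colourable G k
¬hasClique-one⇒colourable G k no-vertex =
  (λ v → contradiction (singleton v) no-vertex) , λ u _ _ → contradiction (singleton u) no-vertex
  where
  singleton : V G → HasClique G 1
  singleton v = isClique⇒hasClique G {K = v ∷ []} λ { zero zero 0≢0 → contradiction refl 0≢0 }

record Enumeration {n : ℕ} (P : Pred (Fin n) 0ℓ) : Set where
  field
    count           : ℕ
    index           : Fin count → Fin n
    index-injective : Injective _≡_ _≡_ index
    index∈P         : ∀ i → P (index i)
    position        : ∀ {v} → P v → Fin count
    index-position  : ∀ {v} (v∈P : P v) → index (position v∈P) ≡ v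

enumerate : ∀ {n} {P : Pred (Fin n) 0ℓ} → Decidable P → Enumeration P
enumerate {zero} P? = record
  { count = 0 ; index = λ () ; index-injective = λ {} ; index∈P = λ ()
  ; position = λ { {()} } ; index-position = λ { {()} } }
enumerate {suc n} {P} P? with enumerate (P? ∘ suc) | P? zero
... | E | yes 0∈P = record
  { count = suc count
  ; index = zero ∷ suc ∘ index
  ; index-injective = λ { {zero} {zero} _ → refl
                        ; {suc i} {suc j} eq → cong suc (index-injective (suc-injective eq)) }
  ; index∈P = λ { zero → 0∈P ; (suc i) → index∈P i }
  ; position = λ { {zero} _ → zero ; {suc v} v∈P → suc (position v∈P) }
  ; index-position = λ { {zero} _ → refl ; {suc v} v∈P → cong suc (index-position v∈P) } }
  where open Enumeration E
... | E | no 0∉P = record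
  { count = count
  ; index = suc ∘ index
  ; index-injective = index-injective ∘ suc-injective
  ; index∈P = index∈P
  ; position = λ { {zero} 0∈P → contradiction 0∈P 0∉P ; {suc v} v∈P → position v∈P }
  ; index-position = λ { {zero} 0∈P → contradiction 0∈P 0∉P ; {suc v} v∈P → cong suc (index-position v∈P) } }
  where open Enumeration E

module Restriction (G : Graph) {P : Pred (V G) 0ℓ} (P? : Decidable P) where
  open Enumeration (enumerate P?) public

  restriction : Graph
  restriction = induced G index index-injective

  colourable⇒colourableOn : ∀ {k} → Colourable restriction k → ColourableOn G P k
  colourable⇒colourableOn (c , proper) = (λ v∈P → c (position v∈P)) , λ u∈P v∈P uv →
    proper _ _ (subst₂ (Adjacent G) (≡.sym (index-position u∈P)) (≡.sym (index-position v∈P)) uv)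

  clique-in-P : ∀ {k} → HasClique restriction k → Σ (Vector (V G) k) λ K → IsClique G K × (∀ i → P (K i))
  clique-in-P (K , _ , K-clique) = index ∘ K , K-clique , index∈P ∘ K

free-induced : ∀ 𝓖 G {m} (e : Vector (V G) m) (e-injective : Injective _≡_ _≡_ e) →
  Free 𝓖 G → Free 𝓖 (induced G e e-injective)
free-induced 𝓖 G e e-injective G-free H H∈𝓖 (_ , e′ , e′-injective , iso) =
  G-free H H∈𝓖 (_ , e ∘ e′ , e′-injective ∘ e-injective , iso)

-- pK2 0 ∪ᴳ H is H on the nose, since splitAt 0 i reduces to inj₂ i.
free-pK2∪-zero : ∀ 𝓗 G → Free (pK2∪ 0 𝓗) G → Free 𝓗 G
free-pK2∪-zero 𝓗 G G-free H H∈𝓗 = G-free (pK2 0 ∪ᴳ H) (H , H∈𝓗 , refl)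

record InducedEmbedding (H G : Graph) : Set where
  field
    vertex        : Vector (V G) (size H)
    injective     : Injective _≡_ _≡_ vertex
    adj-preserved : ∀ i j → adj G (vertex i) (vertex j) ≡ adj H i j
open InducedEmbedding

containsInduced⇒embedding : ∀ {G H} → ContainsInduced G H → InducedEmbedding H G
containsInduced⇒embedding {G} {H} (_ , e , e-injective , φ , φ-adj) = record
  { vertex        = e ∘ from
  ; injective     = λ {i} {j} eq → begin
      i           ≡⟨ to∘from i ⟨
      to (from i) ≡⟨ cong to (e-injective eq) ⟩
      to (from j) ≡⟨ to∘from j ⟩
      j           ∎
  ; adj-preserved = λ i j → trans (φ-adj (from i) (from j)) (cong₂ (adj H) (to∘from i) (to∘from j)) }
  where
  open Bijection φ using (to; surjection) renaming (to⁻ to from)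
  open Surjection surjection using () renaming (to∘to⁻ to to∘from)
  open ≡-Reasoning

embedding⇒containsInduced : ∀ {G H} → InducedEmbedding H G → ContainsInduced G H
embedding⇒containsInduced {H = H} ι = size H , vertex ι , injective ι , ⤖-id _ , adj-preserved ι

embedding-induced : ∀ {G H m} {e : Vector (V G) m} {e-injective : Injective _≡_ _≡_ e} →
  InducedEmbedding H (induced G e e-injective) → InducedEmbedding H G
embedding-induced {e = e} {e-injective} ι = record
  { vertex = e ∘ vertex ι ; injective = injective ι ∘ e-injective ; adj-preserved = adj-preserved ι }

embedding-∪ : ∀ {G A B} (α : InducedEmbedding A G) (β : InducedEmbedding B G) →
  Separated G (vertex α) (vertex β) → InducedEmbedding (A ∪ᴳ B) G
embedding-∪ {G} {A} {B} α β α-β = record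
  { vertex = vertex α ++ vertex β ; injective = inj ; adj-preserved = pres }
  where
  pres : ∀ i j → adj G ((vertex α ++ vertex β) i) ((vertex α ++ vertex β) j) ≡ unionAdj A B i j
  pres i j with splitAt (size A) i | splitAt (size A) j
  ... | inj₁ a | inj₁ b = adj-preserved α a b
  ... | inj₂ a | inj₂ b = adj-preserved β a b
  ... | inj₁ a | inj₂ b = proj₂ (α-β a b)
  ... | inj₂ a | inj₁ b = trans (sym G _ _) (proj₂ (α-β b a))
  inj : Injective _≡_ _≡_ (vertex α ++ vertex β)
  inj {i} {j} eq with splitAt (size A) i in eqi | splitAt (size A) j in eqj
  ... | inj₁ a | inj₁ b = splitAt-injective (size A) (trans eqi (trans (cong inj₁ (injective α eq)) (≡.sym eqj)))
  ... | inj₂ a | inj₂ b = splitAt-injective (size A) (trans eqi (trans (cong inj₂ (injective β eq)) (≡.sym eqj)))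
  ... | inj₁ a | inj₂ b = contradiction eq (proj₁ (α-β a b))
  ... | inj₂ a | inj₁ b = contradiction (≡.sym eq) (proj₁ (α-β b a))

module _ {G A B : Graph} (ι : InducedEmbedding (A ∪ᴳ B) G) where

  embedding-∪ˡ : InducedEmbedding A G
  embedding-∪ˡ = record
    { vertex = vertex ι ∘ (_↑ˡ size B)
    ; injective = ↑ˡ-injective (size B) _ _ ∘ injective ι
    ; adj-preserved = λ i j → trans (adj-preserved ι _ _) (unionAdj-↑ˡ A B i j) }

  embedding-∪ʳ : InducedEmbedding B G
  embedding-∪ʳ = record
    { vertex = vertex ι ∘ (size A ↑ʳ_)
    ; injective = ↑ʳ-injective (size A) _ _ ∘ injective ι
    ; adj-preserved = λ i j → trans (adj-preserved ι _ _) (unionAdj-↑ʳ A B i j) }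

  embedding-∪-separated : Separated G (vertex embedding-∪ˡ) (vertex embedding-∪ʳ)
  embedding-∪-separated i j =
    ↑ˡ≢↑ʳ (size A) (size B) i j ∘ injective ι , trans (adj-preserved ι _ _) (unionAdj-↑ˡ↑ʳ A B i j)

separated-++ : ∀ G {m n l} {K : Vector (V G) m} {L : Vector (V G) n} {M : Vector (V G) l} →
  Separated G K M → Separated G L M → Separated G (K ++ L) M
separated-++ G {m} K-M L-M i j with splitAt m i
... | inj₁ a = K-M a j
... | inj₂ b = L-M b j

edge-embedding : ∀ G {x y} → Adjacent G x y → InducedEmbedding K2 G
edge-embedding G {x} {y} xy = record
  { vertex = x ∷ y ∷ [] ; injective = inj ; adj-preserved = pres }
  where
  inj : Injective _≡_ _≡_ (x ∷ y ∷ [])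
  inj {zero}     {zero}     _   = refl
  inj {zero}     {suc zero} x≡y = contradiction x≡y (adjacent⇒≢ G xy)
  inj {suc zero} {zero}     y≡x = contradiction (≡.sym y≡x) (adjacent⇒≢ G xy)
  inj {suc zero} {suc zero} _   = refl
  pres : ∀ i j → adj G ((x ∷ y ∷ []) i) ((x ∷ y ∷ []) j) ≡ adj K2 i j
  pres zero       zero       = irrefl G x
  pres zero       (suc zero) = xy
  pres (suc zero) zero       = adjacent-sym G xy
  pres (suc zero) (suc zero) = irrefl G y

edge-separated : ∀ G {x y m} {K : Vector (V G) m} → Adjacent G x y →
  (∀ k → adj G x (K k) ≡ false) → (∀ k → adj G y (K k) ≡ false) → Separated G (x ∷ y ∷ []) K
edge-separated G xy x-K y-K zero       k = neighbour≢non-neighbour G (adjacent-sym G xy) (y-K k) , x-K k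
edge-separated G xy x-K y-K (suc zero) k = neighbour≢non-neighbour G xy (x-K k) , y-K k

-- A copy of qK₂ ∪ H among the common non-neighbours of an edge x y extends by x y to a copy
-- of (q + 1)K₂ ∪ H.
free-beyond-edge : ∀ {q 𝓗 G x y m} {e : Vector (V G) m} {e-injective : Injective _≡_ _≡_ e} →
  Free (pK2∪ (suc q) 𝓗) G → Adjacent G x y →
  (∀ i → adj G x (e i) ≡ false) → (∀ i → adj G y (e i) ≡ false) →
  Free (pK2∪ q 𝓗) (induced G e e-injective)
free-beyond-edge {q} {G = G} {e = e} {e-injective} G-free xy x-e y-e _ (H , H∈𝓗 , refl) copy =
  G-free _ (H , H∈𝓗 , refl) (embedding⇒containsInduced (embedding-∪ edges (embedding-∪ʳ ι) edges-H))
  where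
  ι : InducedEmbedding (pK2 q ∪ᴳ H) G
  ι = embedding-induced {e = e} {e-injective} (containsInduced⇒embedding copy)
  edges : InducedEmbedding (K2 ∪ᴳ pK2 q) G
  edges = embedding-∪ (edge-embedding G xy) (embedding-∪ˡ ι) (edge-separated G xy (x-e ∘ _) (y-e ∘ _))
  edges-H : Separated G (vertex edges) (vertex (embedding-∪ʳ ι))
  edges-H = separated-++ G (edge-separated G xy (x-e ∘ _) (y-e ∘ _)) (embedding-∪-separated ι)

-- fBound p is binomialBound (2 * p); binomialBound (2 * q + 1) counts the colours used on the
-- non-neighbours of a vertex.
binomialBound : ℕ → ℕ → ℕ
binomialBound k n = (n + k) C (k + 1)

binomialBound-one : ∀ k → binomialBound k 1 ≡ 1
binomialBound-one k = trans (cong (suc k C_) (+-comm k 1)) (nCn≡1 (suc k))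

binomialBound-pascal : ∀ k n →
  binomialBound (suc k) n + binomialBound k (suc n) ≡ binomialBound (suc k) (suc n)
binomialBound-pascal k n = begin
  (n + suc k) C suc (k + 1) + suc (n + k) C (k + 1) ≡⟨ cong (λ m → (n + suc k) C suc (k + 1) + m C (k + 1)) (+-suc n k) ⟨
  (n + suc k) C suc (k + 1) + (n + suc k) C (k + 1) ≡⟨ +-comm ((n + suc k) C suc (k + 1)) _ ⟩
  (n + suc k) C (k + 1) + (n + suc k) C suc (k + 1) ≡⟨ nCk+nC[k+1]≡[n+1]C[k+1] (n + suc k) (k + 1) ⟩
  suc (n + suc k) C suc (k + 1)                     ∎
  where open ≡-Reasoning

fBound-zero : ∀ ω → fBound 0 ω ≡ ω
fBound-zero ω = trans (cong (_C 1) (+-identityʳ ω)) (nC1≡n ω)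

fBound-suc : ∀ q ω → fBound (suc q) ω + binomialBound (suc (2 * q)) (suc ω) ≡ fBound (suc q) (suc ω)
fBound-suc q ω = begin
  fBound (suc q) ω + binomialBound (suc (2 * q)) (suc ω)
    ≡⟨ cong (λ k → binomialBound k ω + binomialBound (suc (2 * q)) (suc ω)) (*-suc 2 q) ⟩
  binomialBound (2 + 2 * q) ω + binomialBound (suc (2 * q)) (suc ω)
    ≡⟨ binomialBound-pascal (suc (2 * q)) ω ⟩
  binomialBound (2 + 2 * q) (suc ω)
    ≡⟨ cong (λ k → binomialBound k (suc ω)) (*-suc 2 q) ⟨
  fBound (suc q) (suc ω) ∎
  where open ≡-Reasoning

module _ (𝓗 : Graph → Set) (𝓗-free⇒perfect : ∀ G → Free 𝓗 G → Perfect G) where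

  ColourBound : ℕ → ℕ → Set
  ColourBound p ω = ∀ G → Free (pK2∪ p 𝓗) G → ¬ HasClique G (suc ω) → Colourable G (fBound p ω)

  colourBound-zero : ∀ ω → ColourBound 0 ω
  colourBound-zero ω G G-free no-clique with ω′ , ω′≤ω , isω′ ← cliqueNumber-≤ G ω no-clique =
    colourable-≤ G (≤-trans ω′≤ω (≤-reflexive (≡.sym (fBound-zero ω))))
      (proj₁ (𝓗-free⇒perfect G (free-pK2∪-zero 𝓗 G G-free) id id ω′ isω′))

  module _ (q : ℕ) (colourBound-q : ∀ ω → ColourBound q ω) where

    -- In the step, the vertices adjacent to r = head R are those of the same set for r ∷ P and
    -- tail R; the others miss both ends of the edge x r and are coloured by the induction on q.
    nonNeighbours-colourable : ∀ G → Free (pK2∪ (suc q) 𝓗) G →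
      ∀ x j {t} (P : Vector (V G) t) (R : Vector (V G) j) → ¬ HasClique G (t + (2 + j)) →
      IsClique G P → IsClique G R → Complete G P R → (∀ k → Adjacent G x (R k)) →
      ColourableOn G (∁ (Adjacent G x) ∩ CommonNeighbour G P) (binomialBound (suc (2 * q)) (suc j))
    nonNeighbours-colourable G G-free x zero P R no-clique P-clique _ _ _ =
      subst (ColourableOn G _) (≡.sym (binomialBound-one (suc (2 * q))))
        ((λ _ → zero) , λ u∈S v∈S uv _ → no-clique (isClique⇒hasClique G
          (++-isClique G P-clique (edge-isClique G uv)
            λ i → λ { zero → proj₂ u∈S i ; (suc zero) → proj₂ v∈S i })))
    nonNeighbours-colourable G G-free x (suc j) {t} P R no-clique P-clique R-clique P-R x-R =
      subst (ColourableOn G _) (binomialBound-pascal (2 * q) (suc j))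
        (colourableOn-split G (adjacent? G r) neighbours-of-r non-neighbours-of-r)
      where
      r : V G
      r = head R
      S : Pred (V G) 0ℓ
      S = ∁ (Adjacent G x) ∩ CommonNeighbour G P
      neighbours-of-r : ColourableOn G (S ∩ Adjacent G r) (binomialBound (suc (2 * q)) (suc j))
      neighbours-of-r = colourableOn-⊆ G
        (λ ((v∉N[x] , v∈N[P]) , rv) → v∉N[x] , λ { zero → rv ; (suc i) → v∈N[P] i })
        (nonNeighbours-colourable G G-free x j (r ∷ P) (tail R)
          (no-clique ∘ subst (HasClique G) (≡.sym (+-suc t (2 + j))))
          (∷-isClique G (λ i → P-R i zero) P-clique) (tail-isClique G R-clique)
          (λ { zero k → R-clique zero (suc k) λ () ; (suc i) k → P-R i (suc k) }) (x-R ∘ suc))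
      non-neighbours-of-r : ColourableOn G (S ∩ ∁ (Adjacent G r)) (fBound q (2 + j))
      non-neighbours-of-r = colourable⇒colourableOn (colourBound-q (2 + j) restriction
          (free-beyond-edge {q} {𝓗} {G} {x} {r} {e = index} {index-injective} G-free (x-R zero)
            (λ i → ¬adjacent⇒false G (proj₁ (proj₁ (index∈P i))))
            (λ i → ¬adjacent⇒false G (proj₂ (index∈P i))))
          λ clique → let K , K-clique , K∈S = clique-in-P clique in
            no-clique (isClique⇒hasClique G (++-isClique G P-clique K-clique λ i k → proj₂ (proj₁ (K∈S k)) i)))
        where open Restriction G ((∁? (adjacent? G x) ∩? commonNeighbour? G P) ∩? ∁? (adjacent? G r))

    colourBound-suc : ∀ ω → ColourBound (suc q) ω
    colourBound-suc zero G _ no-vertex = ¬hasClique-one⇒colourable G _ no-vertex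
    colourBound-suc (suc ω) G G-free no-clique with hasClique? G (suc ω)
    ... | no no-smaller-clique =
      colourable-≤ G (≤-trans (m≤m+n _ _) (≤-reflexive (fBound-suc q ω)))
        (colourBound-suc ω G G-free no-smaller-clique)
    ... | yes (K , _ , K-clique) = colourableOn-U⇒colourable G
      (subst (ColourableOn G U) (fBound-suc q ω)
        (colourableOn-split G (adjacent? G x) (colourableOn-⊆ G proj₂ neighbours)
                                              (colourableOn-⊆ G proj₂ non-neighbours)))
      where
      x : V G
      x = head K
      neighbours : ColourableOn G (Adjacent G x) (fBound (suc q) ω)
      neighbours = colourable⇒colourableOn (colourBound-suc ω restriction
          (free-induced _ G index index-injective G-free)
          λ clique → let L , L-clique , L∈N[x] = clique-in-P clique in
            no-clique (isClique⇒hasClique G (∷-isClique G (adjacent-sym G ∘ L∈N[x]) L-clique)))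
        where open Restriction G (adjacent? G x)
      non-neighbours : ColourableOn G (∁ (Adjacent G x)) (binomialBound (suc (2 * q)) (suc ω))
      non-neighbours = colourableOn-⊆ G (λ x≁v → x≁v , λ ())
        (nonNeighbours-colourable G G-free x ω [] (tail K) no-clique
          (λ ()) (tail-isClique G K-clique) (λ ()) (λ k → K-clique zero (suc k) λ ()))

  colourBound : ∀ p ω → ColourBound p ω
  colourBound zero    = colourBound-zero
  colourBound (suc q) = colourBound-suc q (colourBound q)

mainTheorem19 : (p : ℕ) → p ≥ 1 → (𝓗 : Graph → Set) →
    (∀ G → Free 𝓗 G → Perfect G) →
    ChiBounding (Free (pK2∪ p 𝓗)) (fBound p)
mainTheorem19 p _ 𝓗 𝓗-free⇒perfect G G-free ω (_ , no-larger-clique) χ (_ , χ-minimal) =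
  χ-minimal _ (colourBound 𝓗 𝓗-free⇒perfect p ω G G-free no-larger-clique)
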